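{- Let $t$ be a term and $f$ a formula such that $t$ has a top-level occurrence in $f$. Then the well-defined sequent $\vdash_{\mathcal{D}}\ \mathcal{D}(f)\Rightarrow\mathcal{D}(t)$ is provable.
   Context: Fix a first-order signature $\Sigma$: a set $V$ of variables, a set $F$ of function symbols and a set $P$ of predicate symbols, each with an arity. Terms: every variable is a term; if $f\in F$ has arity $n$ and $e_1,\dots,e_n$ are terms then $f(e_1,\dots,e_n)$ is a term. Formulas: $\bot$; $p(t_1,\dots,t_n)$ for $p\in P$ of arity $n$; $t_1=t_2$; $\varphi\land\psi$; $\lnot\varphi$; $\forall x\cdot\varphi$; other connectives ($\lor,\Rightarrow,\Leftrightarrow,\exists,\top$) are the usual abbreviations. Well-definedness operator $\mathcal{D}$: $\mathcal{D}(x)=\top$ for $x\in V$; $\mathcal{D}(f(t_1,\dots,t_n))=\bigwedge_i\mathcal{D}(t_i)\land C^f_{t_1,\dots,t_n}$, with $C^f_{t_1,\dots,t_n}$ a given formula expressing that the arguments lie in the domain of $f$; $\mathcal{D}(p(t_1,\dots,t_n))=\bigwedge_i\mathcal{D}(t_i)$; $\mathcal{D}(t_1=t_2)=\mathcal{D}(t_1)\land\mathcal{D}(t_2)$; $\mathcal{D}(\bot)=\top$; $\mathcal{D}(\lnot\varphi)=\mathcal{D}(\varphi)$; $\mathcal{D}(\varphi\land\psi)=(\mathcal{D}(\varphi)\land\mathcal{D}(\psi))\lor(\mathcal{D}(\varphi)\land\lnot\varphi)\lor(\mathcal{D}(\psi)\land\lnot\psi)$; $\mathcal{D}(\forall x\cdot\varphi)=(\forall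 x\cdot\mathcal{D}(\varphi))\lor(\exists x\cdot\mathcal{D}(\varphi)\land\lnot\varphi)$. A well-defined sequent $H\vdash_{\mathcal{D}} G$ stands for the classical sequent $\mathcal{D}(H),\mathcal{D}(G),H\vdash G$; it is provable if derivable in the calculus FoPCe$_{\mathcal{D}}$ with rules (all on $\vdash_{\mathcal{D}}$-sequents): hyp ($H,P\vdash_{\mathcal{D}}P$); mon (from $H\vdash_{\mathcal{D}}Q$ infer $H,P\vdash_{\mathcal{D}}Q$); contr (from $H,\lnot Q\vdash_{\mathcal{D}}\bot$ infer $H\vdash_{\mathcal{D}}Q$); $\bot$hyp ($H,\bot\vdash_{\mathcal{D}}P$); $\lnot$goal (from $H,P\vdash_{\mathcal{D}}\bot$ infer $H\vdash_{\mathcal{D}}\lnot P$); $\lnot$hyp (from $H\vdash_{\mathcal{D}}P$ infer $H,\lnot P\vdash_{\mathcal{D}}Q$); $\land$goal (from $H\vdash_{\mathcal{D}}P$, $H\vdash_{\mathcal{D}}Q$ infer $H\vdash_{\mathcal{D}}P\land Q$); $\land$hyp (from $H,P,Q\vdash_{\mathcal{D}}R$ infer $H,P\land Q\vdash_{\mathcal{D}}R$); $\forall$goal ($x$ not free in $H$; from $H\vdash_{\mathcal{D}}P$ infer $H\vdash_{\mathcal{D}}\forall x\cdot P$); $=$goal ($H\vdash_{\mathcal{D}}E=E$); $=$hyp (from $H\vdash_{\mathcal{D}}[x:=E]P$ infer $H,E=F\vdash_{\mathcal{D}}[x:=F]P$); cut (from $H\vdash_{\mathcal{D}}\mathcal{D}(P)$,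 $H\vdash_{\mathcal{D}}P$, $H,P\vdash_{\mathcal{D}}Q$ infer $H\vdash_{\mathcal{D}}Q$); $\forall$hyp (from $H\vdash_{\mathcal{D}}\mathcal{D}(E)$ and $H,[x:=E]P\vdash_{\mathcal{D}}Q$ infer $H,\forall x\cdot P\vdash_{\mathcal{D}}Q$). For a position $p$ in a formula $g$, $g[t]_p$ denotes a formula $g$ whose subterm at position $p$ is $t$. Top-level occurrence: a term $t$ has a top-level occurrence in a formula $f$ if $f$ is of the form $q(t_1,\dots,t_n)[t]_p$ with $q\in P$ and $t_1,\dots,t_n$ terms (i.e. $t$ occurs at some position $p$ inside the arguments of an atomic predicate formula), or of the form $(t_1=t_2)[t]_p$ with $t_1,t_2$ terms; moreover, if $t$ has a top-level occurrence in $f$, then it also has a top-level occurrence in $\lnot f$. -}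

module Defs where

open import Data.Nat using (ℕ; zero; suc)
open import Data.Vec using (Vec; []; _∷_)
open import Data.Vec.Relation.Unary.Any using (Any)
open import Data.List using (List; []; _∷_; map)

-- A first-order signature: function and predicate symbols with arities.
-- Variables are de Bruijn indices (ℕ).
record Signature : Set₁ where
  field
    Fun    : Set
    farity : Fun → ℕ
    Pred   : Set
    parity : Pred → ℕ

module Syntax (S : Signature) where
  open Signature S

  data Term : Set where
    var : ℕ → Term
    fun : (g : Fun) → Vec Term (farity g) → Term

  infix  6 ¬'_
  infixr 5 _∧'_
  infix  7 _≐_

  data Formula : Set where
    ⊥'   : Formula
    pred : (q : Pred) → Vec Term (parity q) → Formula
    _≐_  : Term → Term → Formula
    _∧'_ : Formula → Formula → Formula
    ¬'_  : Formula → Formula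
    ∀'_  : Formula → Formula       -- binds de Bruijn index 0

  ⊤' : Formula
  ⊤' = ¬' ⊥'

  _∨'_ : Formula → Formula → Formula
  A ∨' B = ¬' (¬' A ∧' ¬' B)

  _⇒'_ : Formula → Formula → Formula
  A ⇒' B = ¬' (A ∧' ¬' B)

  ∃'_ : Formula → Formula
  ∃' A = ¬' (∀' (¬' A))

  ext : (ℕ → ℕ) → ℕ → ℕ
  ext ρ zero    = zero
  ext ρ (suc n) = suc (ρ n)

  mutual
    renT : (ℕ → ℕ) → Term → Term
    renT ρ (var x)    = var (ρ x)
    renT ρ (fun g ts) = fun g (renTs ρ ts)

    renTs : ∀ {n} → (ℕ → ℕ) → Vec Term n → Vec Term n
    renTs ρ []       = []
    renTs ρ (t ∷ ts) = renT ρ t ∷ renTs ρ ts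

  renF : (ℕ → ℕ) → Formula → Formula
  renF ρ ⊥'         = ⊥'
  renF ρ (pred q ts) = pred q (renTs ρ ts)
  renF ρ (a ≐ b)    = renT ρ a ≐ renT ρ b
  renF ρ (A ∧' B)   = renF ρ A ∧' renF ρ B
  renF ρ (¬' A)     = ¬' renF ρ A
  renF ρ (∀' A)     = ∀' renF (ext ρ) A

  shiftF : Formula → Formula
  shiftF = renF suc

  exts : (ℕ → Term) → ℕ → Term
  exts σ zero    = var zero
  exts σ (suc n) = renT suc (σ n)

  mutual
    subT : (ℕ → Term) → Term → Term
    subT σ (var x)    = σ x
    subT σ (fun g ts) = fun g (subTs σ ts)

    subTs : ∀ {n} → (ℕ → Term) → Vec Term n → Vec Term n
    subTs σ []       = []
    subTs σ (t ∷ ts) = subT σ t ∷ subTs σ ts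

  subF : (ℕ → Term) → Formula → Formula
  subF σ ⊥'          = ⊥'
  subF σ (pred q ts) = pred q (subTs σ ts)
  subF σ (a ≐ b)     = subT σ a ≐ subT σ b
  subF σ (A ∧' B)    = subF σ A ∧' subF σ B
  subF σ (¬' A)      = ¬' subF σ A
  subF σ (∀' A)      = ∀' subF (exts σ) A

  -- [x := E] P, where x is de Bruijn index 0 of P
  sub0σ : Term → ℕ → Term
  sub0σ E zero    = E
  sub0σ E (suc n) = var n

  sub0 : Term → Formula → Formula
  sub0 E = subF (sub0σ E)

  data _⊑_ (t : Term) : Term → Set where
    here   : t ⊑ t
    inside : ∀ {g ts} → Any (t ⊑_) ts → t ⊑ fun g ts

  data TopLevel (t : Term) : Formula → Set where
    atom : ∀ {q ts} → Any (t ⊑_) ts → TopLevel t (pred q ts)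
    eqˡ  : ∀ {u v} → t ⊑ u → TopLevel t (u ≐ v)
    eqʳ  : ∀ {u v} → t ⊑ v → TopLevel t (u ≐ v)
    neg  : ∀ {f} → TopLevel t f → TopLevel t (¬' f)

DomCond : Signature → Set
DomCond S = (g : Signature.Fun S) → Vec (Syntax.Term S) (Signature.farity S g) → Syntax.Formula S

module Calculus (S : Signature) (C : DomCond S) where
  open Signature S
  open Syntax S

  mutual
    DT : Term → Formula
    DT (var x)    = ⊤'
    DT (fun g ts) = DTs ts ∧' C g ts

    DTs : ∀ {n} → Vec Term n → Formula
    DTs []       = ⊤'
    DTs (t ∷ ts) = DT t ∧' DTs ts

  DF : Formula → Formula
  DF ⊥'          = ⊤'
  DF (pred q ts) = DTs ts
  DF (a ≐ b)     = DT a ∧' DT b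
  DF (A ∧' B)    = ((DF A ∧' DF B) ∨' (DF A ∧' ¬' A)) ∨' (DF B ∧' ¬' B)
  DF (¬' A)      = DF A
  DF (∀' A)      = (∀' DF A) ∨' (∃' (DF A ∧' ¬' A))

  infix 2 _⊢_

  -- well-defined sequents H ⊢_D G of FoPCe_D; "H , P" is written P ∷ H
  data _⊢_ : List Formula → Formula → Set where
    hyp    : ∀ {H P} → P ∷ H ⊢ P
    mon    : ∀ {H P Q} → H ⊢ Q → P ∷ H ⊢ Q
    contr  : ∀ {H Q} → ¬' Q ∷ H ⊢ ⊥' → H ⊢ Q
    ⊥hyp   : ∀ {H P} → ⊥' ∷ H ⊢ P
    ¬goal  : ∀ {H P} → P ∷ H ⊢ ⊥' → H ⊢ ¬' P
    ¬hyp   : ∀ {H P Q} → H ⊢ P → ¬' P ∷ H ⊢ Q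
    ∧goal  : ∀ {H P Q} → H ⊢ P → H ⊢ Q → H ⊢ P ∧' Q
    ∧hyp   : ∀ {H P Q R} → Q ∷ P ∷ H ⊢ R → (P ∧' Q) ∷ H ⊢ R
    ∀goal  : ∀ {H P} → map shiftF H ⊢ P → H ⊢ ∀' P
    =goal  : ∀ {H E} → H ⊢ E ≐ E
    =hyp   : ∀ {H E F} (P : Formula) → H ⊢ sub0 E P → (E ≐ F) ∷ H ⊢ sub0 F P
    cut    : ∀ {H P Q} → H ⊢ DF P → H ⊢ P → P ∷ H ⊢ Q → H ⊢ Q
    ∀hyp   : ∀ {H P Q} (E : Term) → H ⊢ DT E → sub0 E P ∷ H ⊢ Q → (∀' P) ∷ H ⊢ Q

module Submission where

-- The well-definedness condition of a term contains, as a
-- conjunct, the well-definedness condition of each of its arguments, and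
-- hence (by induction on the position) that of every subterm.  If t occurs
-- at top level in f, then f is, up to negations, an atom whose
-- well-definedness condition is the conjunction of the conditions of its
-- argument terms, one of which contains t.  So D(f) entails D(t) by
-- projecting conjunctions only.

open import Data.List using ([]; _∷_)
open import Data.Vec using (Vec)
open import Data.Vec.Relation.Unary.Any using (Any; here; there)
open import Defs

module Entailment (S : Signature) (C : DomCond S) where
  open Syntax S
  open Calculus S C

  -- Implication introduction: P ⇒ Q abbreviates ¬(P ∧ ¬Q), so it suffices
  -- to refute P ∧ ¬Q, i.e. to derive Q from P.
  ⇒-intro : ∀ {H P Q} → P ∷ H ⊢ Q → H ⊢ P ⇒' Q
  ⇒-intro P⊢Q = ¬goal (∧hyp (¬hyp P⊢Q))

  -- Left projection of a conjunctive hypothesis.  (The right projection is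
  -- ∧hyp itself, keeping the left conjunct as an extra hypothesis; all
  -- lemmas below hold in every context, so that extra hypothesis is harmless.)
  ∧-projˡ : ∀ {H P Q R} → P ∷ H ⊢ R → (P ∧' Q) ∷ H ⊢ R
  ∧-projˡ P⊢R = ∧hyp (mon P⊢R)

  mutual
    -- The well-definedness of a term entails that of each of its subterms:
    -- D(g(u₁,…,uₙ)) = (D(u₁) ∧ … ∧ D(uₙ) ∧ ⊤) ∧ C^g, so follow the position.
    D-subterm : ∀ {H t u} → t ⊑ u → DT u ∷ H ⊢ DT t
    D-subterm here       = hyp
    D-subterm (inside a) = ∧-projˡ (D-argument a)

    D-argument : ∀ {H t n} {ts : Vec Term n} → Any (t ⊑_) ts → DTs ts ∷ H ⊢ DT t
    D-argument (here t⊑u) = ∧-projˡ (D-subterm t⊑u)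
    D-argument (there a)  = ∧hyp (D-argument a)

  -- A top-level occurrence of t in f sits inside the arguments of the atom
  -- (predicate or equation) below the negations of f, and D ignores
  -- negations; hence D(f) entails D(t).
  D-topLevel : ∀ {H t f} → TopLevel t f → DF f ∷ H ⊢ DT t
  D-topLevel (atom a)  = D-argument a
  D-topLevel (eqˡ t⊑u) = ∧-projˡ (D-subterm t⊑u)
  D-topLevel (eqʳ t⊑v) = ∧hyp (D-subterm t⊑v)
  D-topLevel (neg occ) = D-topLevel occ

proposition1 : (S : Signature) (C : DomCond S)
    (t : Syntax.Term S) (f : Syntax.Formula S) → Syntax.TopLevel S t f
    → Calculus._⊢_ S C [] (Syntax._⇒'_ S (Calculus.DF S C f) (Calculus.DT S C t))
proposition1 S C t f occ = ⇒-intro (D-topLevel occ)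
  where open Entailment S C
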